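{- Let $\Gamma\cup\{\phi\}$ be a set of formulas in the language of $\mathbb{MPT}$ and $\sigma$ a classical substitution. If $\Gamma\models\phi$, then $\{\sigma(\gamma):\gamma\in\Gamma\}\models\sigma(\phi)$.
   Context: Variables $p_i$ ($i\in\mathbb N$); a valuation is $s:\mathbb N\to\{0,1\}$; a team is a set of valuations. Classical formulas: $\alpha::=p_i\mid\neg p_i\mid\bot\mid\alpha\wedge\alpha\mid\alpha\otimes\alpha$. Formulas of $\mathbb{MPT}$: $\phi::=p_i\mid\neg p_i\mid\neg\alpha\mid\top\mid\mathrm{NE}\mid\bot\mid\vec\alpha\perp\vec\beta\mid{=}(\vec\alpha,\beta)\mid\vec\alpha\subseteq\vec\beta\mid\phi\wedge\phi\mid\phi\otimes\phi\mid\phi\circledast\phi\mid\phi\vee\phi$, where $\alpha,\beta$ are classical formulas and $\vec\alpha=\alpha_1\dots\alpha_k$, $\vec\beta$ finite sequences of classical formulas (of equal length for $\subseteq$); in particular propositional variables may be used as arguments. For sequences $\vec\alpha,\vec\beta$ of length $k$ write $s\sim_{(\vec\alpha,\vec\beta)}s'$ iff for all $i\le k$ ($\{s\}\models\alpha_i\iff\{s'\}\models\beta_i$), and $\sim_{\vec\alpha}:=\sim_{(\vec\alpha,\vec\alpha)}$. Semantics: $X\models p_i$ iff $s(i)=1$ for all $s\in X$; $X\models\neg p_i$ iff $s(i)=0$ for all $s\in X$; $X\models\neg\alpha$ iff $\{s\}\not\models\alpha$ for all $s\in X$; $X\models\top$ always; $X\models\bot$ iff $X=\emptyset$; $X\models\mathrm{NE}$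 iff $X\ne\emptyset$; $X\models\vec\alpha\perp\vec\beta$ iff for all $s,s'\in X$ there is $s''\in X$ with $s\sim_{\vec\alpha}s''$ and $s'\sim_{\vec\beta}s''$; $X\models{=}(\vec\alpha,\beta)$ iff for all $s,s'\in X$, $s\sim_{\vec\alpha}s'$ implies $s\sim_\beta s'$; $X\models\vec\alpha\subseteq\vec\beta$ iff for all $s\in X$ there is $s'\in X$ with $s\sim_{(\vec\alpha,\vec\beta)}s'$; $X\models\phi\wedge\psi$ iff both; $X\models\phi\otimes\psi$ iff $X=Y\cup Z$ with $Y\models\phi$, $Z\models\psi$; $X\models\phi\circledast\psi$ iff $X=\emptyset$ or $X=Y\cup Z$ with $Y,Z$ nonempty, $Y\models\phi$, $Z\models\psi$; $X\models\phi\vee\psi$ iff $X\models\phi$ or $X\models\psi$. $\Gamma\models\phi$: every team satisfying all of $\Gamma$ satisfies $\phi$. A classical substitution is a map $\sigma$ assigning to each variable $p_i$ a classical formula $\sigma(p_i)$, extended to all $\mathbb{MPT}$-formulas by commuting with all connectives and atoms: $\sigma(\neg\alpha)=\neg\sigma(\alpha)$, $\sigma(\mathrm{NE})=\mathrm{NE}$, $\sigma(\bot)=\bot$, $\sigma(\top)=\top$, $\sigma(\vec\alpha\perp\vec\beta)=\sigma(\vec\alpha)\perp\sigma(\vec\beta)$, $\sigma({=}(\vec\alpha,\beta))={=}(\sigma(\vec\alpha),\sigma(\beta))$, $\sigma(\vec\alpha\subseteq\vec\beta)=\sigma(\vec\alpha)\subseteq\sigma(\vec\beta)$, $\sigma(\phi\circ\psi)=\sigma(\phi)\circ\sigma(\psi)$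 for $\circ\in\{\wedge,\otimes,\circledast,\vee\}$ (componentwise on sequences). -}

module Defs where

open import Data.Nat using (ℕ)
open import Data.Bool using (Bool; true; false)
open import Data.List using (List; []; _∷_)
open import Data.Vec using (Vec; []; _∷_)
open import Data.Product using (Σ; ∃; _×_; _,_)
open import Data.Sum using (_⊎_)
open import Data.Empty using (⊥)
open import Data.Unit.Polymorphic using (⊤)
open import Level using (Level; lift; Lift) renaming (suc to lsuc; zero to lzero)
open import Relation.Nullary using (¬_)
open import Relation.Binary.PropositionalEquality using (_≡_)

Valuation : Set
Valuation = ℕ → Bool

Team : Set₁
Team = Valuation → Set

Empty : Team → Set
Empty X = ∀ s → ¬ X s

NonEmpty : Team → Set
NonEmpty X = ∃ λ s → X s

IsUnion : Team → Team → Team → Set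
IsUnion X Y Z = ∀ s → (X s → Y s ⊎ Z s) × (Y s ⊎ Z s → X s)

⟦_⟧ : Valuation → Team
⟦ s ⟧ s' = s' ≡ s

data CF : Set where
  cp   : ℕ → CF
  cnp  : ℕ → CF
  c⊥   : CF
  _c∧_ : CF → CF → CF
  _c⊗_ : CF → CF → CF

infix 4 _⊨ᶜ_
_⊨ᶜ_ : Team → CF → Set₁
X ⊨ᶜ cp i = Lift (lsuc lzero) (∀ s → X s → s i ≡ true)
X ⊨ᶜ cnp i = Lift (lsuc lzero) (∀ s → X s → s i ≡ false)
X ⊨ᶜ c⊥ = Lift (lsuc lzero) (Empty X)
X ⊨ᶜ (α c∧ β) = (X ⊨ᶜ α) × (X ⊨ᶜ β)
X ⊨ᶜ (α c⊗ β) = Σ Team λ Y → Σ Team λ Z → Lift (lsuc lzero) (IsUnion X Y Z) × (Y ⊨ᶜ α) × (Z ⊨ᶜ β)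

SimV : ∀ {k} → Vec CF k → Vec CF k → Valuation → Valuation → Set₁
SimV [] [] s s' = ⊤ {lsuc lzero}
SimV (α ∷ as) (β ∷ bs) s s' =
  ((⟦ s ⟧ ⊨ᶜ α → ⟦ s' ⟧ ⊨ᶜ β) × (⟦ s' ⟧ ⊨ᶜ β → ⟦ s ⟧ ⊨ᶜ α)) × SimV as bs s s'

Sim : List CF → Valuation → Valuation → Set₁
Sim [] s s' = ⊤ {lsuc lzero}
Sim (α ∷ as) s s' =
  ((⟦ s ⟧ ⊨ᶜ α → ⟦ s' ⟧ ⊨ᶜ α) × (⟦ s' ⟧ ⊨ᶜ α → ⟦ s ⟧ ⊨ᶜ α)) × Sim as s s'

data MPT : Set where
  p     : ℕ → MPT
  np    : ℕ → MPT
  ¬c    : CF → MPT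
  ⊤f    : MPT
  NE    : MPT
  ⊥f    : MPT
  indep : List CF → List CF → MPT
  dep   : List CF → CF → MPT
  incl  : ∀ {k} → Vec CF k → Vec CF k → MPT
  _∧f_  : MPT → MPT → MPT
  _⊗f_  : MPT → MPT → MPT
  _⊛f_  : MPT → MPT → MPT
  _∨f_  : MPT → MPT → MPT

infix 4 _⊨_
_⊨_ : Team → MPT → Set₁
X ⊨ p i = Lift (lsuc lzero) (∀ s → X s → s i ≡ true)
X ⊨ np i = Lift (lsuc lzero) (∀ s → X s → s i ≡ false)
X ⊨ ¬c α = ∀ s → X s → ¬ (⟦ s ⟧ ⊨ᶜ α)
X ⊨ ⊤f = ⊤ {lsuc lzero}
X ⊨ NE = Lift (lsuc lzero) (NonEmpty X)
X ⊨ ⊥f = Lift (lsuc lzero) (Empty X)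
X ⊨ indep as bs = ∀ s s' → X s → X s' →
  Σ Valuation λ s'' → Lift (lsuc lzero) (X s'') × Sim as s s'' × Sim bs s' s''
X ⊨ dep as β = ∀ s s' → X s → X s' → Sim as s s' → Sim (β ∷ []) s s'
X ⊨ incl as bs = ∀ s → X s → Σ Valuation λ s' → Lift (lsuc lzero) (X s') × SimV as bs s s'
X ⊨ (φ ∧f ψ) = (X ⊨ φ) × (X ⊨ ψ)
X ⊨ (φ ⊗f ψ) = Σ Team λ Y → Σ Team λ Z → Lift (lsuc lzero) (IsUnion X Y Z) × (Y ⊨ φ) × (Z ⊨ ψ)
X ⊨ (φ ⊛f ψ) = Lift (lsuc lzero) (Empty X) ⊎
  (Σ Team λ Y → Σ Team λ Z → Lift (lsuc lzero) (IsUnion X Y Z × NonEmpty Y × NonEmpty Z) × (Y ⊨ φ) × (Z ⊨ ψ))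
X ⊨ (φ ∨f ψ) = (X ⊨ φ) ⊎ (X ⊨ ψ)

infix 3 _⊩_
_⊩_ : (MPT → Set) → MPT → Set₁
Γ ⊩ φ = ∀ (X : Team) → (∀ γ → Γ γ → X ⊨ γ) → X ⊨ φ

ClassicalSubst : Set
ClassicalSubst = ℕ → CF

-- classical negation inside classical formulas (negation normal form);
-- ⊤ is expressed by the classical formula p₀ ⊗ ¬p₀
negC : CF → CF
negC (cp i) = cnp i
negC (cnp i) = cp i
negC c⊥ = cp 0 c⊗ cnp 0
negC (α c∧ β) = negC α c⊗ negC β
negC (α c⊗ β) = negC α c∧ negC β

substC : ClassicalSubst → CF → CF
substC σ (cp i) = σ i
substC σ (cnp i) = negC (σ i)
substC σ c⊥ = c⊥
substC σ (α c∧ β) = substC σ α c∧ substC σ β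
substC σ (α c⊗ β) = substC σ α c⊗ substC σ β

substL : ClassicalSubst → List CF → List CF
substL σ [] = []
substL σ (α ∷ as) = substC σ α ∷ substL σ as

substV : ∀ {k} → ClassicalSubst → Vec CF k → Vec CF k
substV σ [] = []
substV σ (α ∷ as) = substC σ α ∷ substV σ as

emb : CF → MPT
emb (cp i) = p i
emb (cnp i) = np i
emb c⊥ = ⊥f
emb (α c∧ β) = emb α ∧f emb β
emb (α c⊗ β) = emb α ⊗f emb β

subst : ClassicalSubst → MPT → MPT
subst σ (p i) = emb (σ i)
subst σ (np i) = ¬c (σ i)
subst σ (¬c α) = ¬c (substC σ α)
subst σ ⊤f = ⊤f
subst σ NE = NE
subst σ ⊥f = ⊥f
subst σ (indep as bs) = indep (substL σ as) (substL σ bs)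
subst σ (dep as β) = dep (substL σ as) (substC σ β)
subst σ (incl as bs) = incl (substV σ as) (substV σ bs)
subst σ (φ ∧f ψ) = subst σ φ ∧f subst σ ψ
subst σ (φ ⊗f ψ) = subst σ φ ⊗f subst σ ψ
subst σ (φ ⊛f ψ) = subst σ φ ⊛f subst σ ψ
subst σ (φ ∨f ψ) = subst σ φ ∨f subst σ ψ

substSet : ClassicalSubst → (MPT → Set) → (MPT → Set)
substSet σ Γ ψ = ∃ λ γ → Γ γ × (ψ ≡ subst σ γ)

module Submission where

-- A classical substitution σ induces a map on valuations,
--   substVal σ s = (i ↦ truth value of σ(p_i) at s),
-- and the whole argument rests on the identity  X ⊨ σ(φ)  iff  substVal σ [X] ⊨ φ.
-- Given this, if X satisfies every σ(γ) with γ ∈ Γ, then the image team satisfies Γ,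
-- hence φ, hence X satisfies σ(φ).
--
-- Images are handled up to extensional equality, since the
--      split of a team into Y ∪ Z only determines its parts extensionally.
--   4. The identity above, proved by induction on φ in both directions; then the theorem.

open import Defs
open import Data.Bool using (Bool; true; false; not; _∧_; _∨_; T)
open import Data.Bool.Properties using (T-≡; T-not-≡; T-∧; T-∨; not-involutive; ∨-inverseʳ; ∨-∧-booleanAlgebra)
open import Algebra.Lattice.Properties.BooleanAlgebra ∨-∧-booleanAlgebra using (deMorgan₁; deMorgan₂)
open import Data.List using ([]; _∷_)
open import Data.Vec using (Vec; []; _∷_)
open import Data.Product using (Σ; ∃; _×_; _,_; proj₁; proj₂; map₂)
open import Data.Product.Function.NonDependent.Propositional using (_×-⇔_)
open import Data.Sum using (_⊎_; inj₁; inj₂; [_,_]) renaming (map to ⊎-map)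
open import Data.Empty using (⊥-elim)
open import Data.Unit.Polymorphic using (tt)
open import Level using (lift; Lift) renaming (suc to lsuc; zero to lzero)
open import Function using (_∘_; _⇔_; mk⇔; Equivalence)
open import Function.Construct.Identity using (⇔-id)
open import Function.Related.TypeIsomorphisms using (→-cong-⇔)
open import Relation.Nullary using (¬_)
open import Relation.Binary.PropositionalEquality using (_≡_; refl; sym; cong₂; module ≡-Reasoning) renaming (subst to substEq)

open Equivalence using (to; from)
open ≡-Reasoning

eval : CF → Valuation → Bool
eval (cp i) s = s i
eval (cnp i) s = not (s i)
eval c⊥ s = false
eval (α c∧ β) s = eval α s ∧ eval β s
eval (α c⊗ β) s = eval α s ∨ eval β s

Holds : Team → CF → Set
Holds X α = ∀ s → X s → T (eval α s)

restrict : Team → CF → Team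
restrict X α s = X s × T (eval α s)

flat : ∀ X α → X ⊨ᶜ α ⇔ Holds X α
flat X α = mk⇔ (sound X α) (complete X α)
  where
  sound : ∀ X α → X ⊨ᶜ α → Holds X α
  sound X (cp i) (lift h) s x = from T-≡ (h s x)
  sound X (cnp i) (lift h) s x = from T-not-≡ (h s x)
  sound X c⊥ (lift h) s x = ⊥-elim (h s x)
  sound X (α c∧ β) (hα , hβ) s x = from T-∧ (sound X α hα s x , sound X β hβ s x)
  sound X (α c⊗ β) (Y , Z , lift u , hα , hβ) s x =
    from T-∨ (⊎-map (sound Y α hα s) (sound Z β hβ s) (proj₁ (u s) x))

  complete : ∀ X α → Holds X α → X ⊨ᶜ α
  complete X (cp i) h = lift λ s x → to T-≡ (h s x)
  complete X (cnp i) h = lift λ s x → to T-not-≡ (h s x)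
  complete X c⊥ h = lift h
  complete X (α c∧ β) h =
    complete X α (λ s x → proj₁ (to T-∧ (h s x))) , complete X β (λ s x → proj₂ (to T-∧ (h s x)))
  complete X (α c⊗ β) h =
    restrict X α , restrict X β , lift split ,
    complete (restrict X α) α (λ _ → proj₂) , complete (restrict X β) β (λ _ → proj₂)
    where
    split : IsUnion X (restrict X α) (restrict X β)
    split s = (λ x → ⊎-map (x ,_) (x ,_) (to T-∨ (h s x))) , [ proj₁ , proj₁ ]

singleton : ∀ s α → ⟦ s ⟧ ⊨ᶜ α ⇔ T (eval α s)
singleton s α = mk⇔ (λ h → to (flat ⟦ s ⟧ α) h s refl) (λ e → from (flat ⟦ s ⟧ α) λ { _ refl → e })

emb-sat : ∀ X α → X ⊨ emb α ⇔ X ⊨ᶜ α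
emb-sat X (cp i) = ⇔-id _
emb-sat X (cnp i) = ⇔-id _
emb-sat X c⊥ = ⇔-id _
emb-sat X (α c∧ β) = emb-sat X α ×-⇔ emb-sat X β
emb-sat X (α c⊗ β) = mk⇔
  (λ { (Y , Z , u , hα , hβ) → Y , Z , u , to (emb-sat Y α) hα , to (emb-sat Z β) hβ })
  (λ { (Y , Z , u , hα , hβ) → Y , Z , u , from (emb-sat Y α) hα , from (emb-sat Z β) hβ })

¬T⇔T-not : ∀ {b} → (¬ T b) ⇔ T (not b)
¬T⇔T-not {true} = mk⇔ (λ k → k _) (λ ())
¬T⇔T-not {false} = mk⇔ (λ _ → _) (λ _ ())

eval-negC : ∀ α s → eval (negC α) s ≡ not (eval α s)
eval-negC (cp i) s = refl
eval-negC (cnp i) s = sym (not-involutive (s i))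
eval-negC c⊥ s = ∨-inverseʳ (s 0)
eval-negC (α c∧ β) s = begin
  eval (negC α) s ∨ eval (negC β) s   ≡⟨ cong₂ _∨_ (eval-negC α s) (eval-negC β s) ⟩
  not (eval α s) ∨ not (eval β s)     ≡⟨ sym (deMorgan₁ (eval α s) (eval β s)) ⟩
  not (eval α s ∧ eval β s)           ∎
eval-negC (α c⊗ β) s = begin
  eval (negC α) s ∧ eval (negC β) s   ≡⟨ cong₂ _∧_ (eval-negC α s) (eval-negC β s) ⟩
  not (eval α s) ∧ not (eval β s)     ≡⟨ sym (deMorgan₂ (eval α s) (eval β s)) ⟩
  not (eval α s ∨ eval β s)           ∎

agreement-cong : ∀ {a a' b b'} {A : Set a} {A' : Set a'} {B : Set b} {B' : Set b'} →
  A ⇔ A' → B ⇔ B' → ((A → B) × (B → A)) ⇔ ((A' → B') × (B' → A'))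
agreement-cong A⇔A' B⇔B' = →-cong-⇔ A⇔A' B⇔B' ×-⇔ →-cong-⇔ B⇔B' A⇔A'

_⊆_ : Team → Team → Set
V ⊆ U = ∀ t → V t → U t

⊆-unionˡ : ∀ {U V W} → IsUnion U V W → V ⊆ U
⊆-unionˡ u t v = proj₂ (u t) (inj₁ v)

⊆-unionʳ : ∀ {U V W} → IsUnion U V W → W ⊆ U
⊆-unionʳ u t w = proj₂ (u t) (inj₂ w)

module _ (σ : ClassicalSubst) where

  substVal : Valuation → Valuation
  substVal s i = eval (σ i) s

  eval-substC : ∀ α s → eval (substC σ α) s ≡ eval α (substVal s)
  eval-substC (cp i) s = refl
  eval-substC (cnp i) s = eval-negC (σ i) s
  eval-substC c⊥ s = refl
  eval-substC (α c∧ β) s = cong₂ _∧_ (eval-substC α s) (eval-substC β s)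
  eval-substC (α c⊗ β) s = cong₂ _∨_ (eval-substC α s) (eval-substC β s)

  singleton-subst : ∀ α s → ⟦ s ⟧ ⊨ᶜ substC σ α ⇔ ⟦ substVal s ⟧ ⊨ᶜ α
  singleton-subst α s = mk⇔
    (λ h → from (singleton (substVal s) α) (substEq T (eval-substC α s) (to (singleton s _) h)))
    (λ h → from (singleton s _) (substEq T (sym (eval-substC α s)) (to (singleton (substVal s) α) h)))

  sim-subst : ∀ as s s' → Sim (substL σ as) s s' ⇔ Sim as (substVal s) (substVal s')
  sim-subst [] s s' = ⇔-id _
  sim-subst (α ∷ as) s s' =
    agreement-cong (singleton-subst α s) (singleton-subst α s') ×-⇔ sim-subst as s s'

  simV-subst : ∀ {k} (as bs : Vec CF k) s s' →
    SimV (substV σ as) (substV σ bs) s s' ⇔ SimV as bs (substVal s) (substVal s')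
  simV-subst [] [] s s' = ⇔-id _
  simV-subst (α ∷ as) (β ∷ bs) s s' =
    agreement-cong (singleton-subst α s) (singleton-subst β s') ×-⇔ simV-subst as bs s s'

  image : Team → Team
  image X t = ∃ λ s → X s × substVal s ≡ t

  infix 4 _IsImageOf_
  _IsImageOf_ : Team → Team → Set
  U IsImageOf X = ∀ t → U t ⇔ image X t

  image-isImage : ∀ X → image X IsImageOf X
  image-isImage X t = ⇔-id _

  in-image : ∀ {X U s} → U IsImageOf X → X s → U (substVal s)
  in-image I x = from (I _) (_ , x , refl)

  image-all : ∀ {ℓ} {P : Valuation → Set ℓ} {X U} → U IsImageOf X →
    (∀ s → X s → P (substVal s)) → ∀ t → U t → P t
  image-all I h t u with to (I t) u
  ... | s , x , refl = h s x

  image-all₂ : ∀ {ℓ} {R : Valuation → Valuation → Set ℓ} {X U} → U IsImageOf X →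
    (∀ s s' → X s → X s' → R (substVal s) (substVal s')) → ∀ t t' → U t → U t' → R t t'
  image-all₂ {R = R} I h t t' u u' =
    image-all {P = λ t → R t t'} I
      (λ s x → image-all {P = R (substVal s)} I (λ s' x' → h s s' x x') t' u') t u

  pull-witness : ∀ {P : Valuation → Set₁} {X U} → U IsImageOf X →
    (Σ Valuation λ t → Lift (lsuc lzero) (U t) × P t) →
    Σ Valuation λ s → Lift (lsuc lzero) (X s) × P (substVal s)
  pull-witness I (t , lift u , holds) with to (I t) u
  ... | s , x , refl = s , lift x , holds

  push-witness : ∀ {P : Valuation → Set₁} {X U} → U IsImageOf X →
    (Σ Valuation λ s → Lift (lsuc lzero) (X s) × P (substVal s)) →
    Σ Valuation λ t → Lift (lsuc lzero) (U t) × P t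
  push-witness I (s , lift x , holds) = substVal s , lift (in-image I x) , holds

  image-empty : ∀ {X U} → U IsImageOf X → Empty X ⇔ Empty U
  image-empty I = mk⇔ (λ e → image-all I e) (λ e s x → e _ (in-image I x))

  image-nonempty : ∀ {X U} → U IsImageOf X → NonEmpty X ⇔ NonEmpty U
  image-nonempty I = mk⇔ (λ { (s , x) → substVal s , in-image I x })
                         (λ { (t , u) → map₂ proj₁ (to (I t) u) })

  image-union : ∀ {X Y Z U} → U IsImageOf X → IsUnion X Y Z → IsUnion U (image Y) (image Z)
  image-union {X} {Y} {Z} {U} I u t =
    image-all {P = λ t → image Y t ⊎ image Z t} I split t , merge
    where
    split : ∀ s → X s → image Y (substVal s) ⊎ image Z (substVal s)
    split s x = ⊎-map (λ y → s , y , refl) (λ z → s , z , refl) (proj₁ (u s) x)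
    merge : image Y t ⊎ image Z t → U t
    merge (inj₁ (s , y , e)) = from (I t) (s , proj₂ (u s) (inj₁ y) , e)
    merge (inj₂ (s , z , e)) = from (I t) (s , proj₂ (u s) (inj₂ z) , e)

  preimage : Team → Team → Team
  preimage X V s = X s × V (substVal s)

  preimage-union : ∀ {X U V W} → U IsImageOf X → IsUnion U V W →
    IsUnion X (preimage X V) (preimage X W)
  preimage-union I u s =
    (λ x → ⊎-map (x ,_) (x ,_) (proj₁ (u (substVal s)) (in-image I x))) , [ proj₁ , proj₁ ]

  preimage-image : ∀ {X U V} → U IsImageOf X → V ⊆ U → V IsImageOf preimage X V
  preimage-image {X} {U} {V} I V⊆U t = mk⇔ pull push
    where
    pull : V t → image (preimage X V) t
    pull v with to (I t) (V⊆U t v)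
    ... | s , x , refl = s , (x , v) , refl
    push : image (preimage X V) t → V t
    push (s , (_ , v) , refl) = v

  subst-to-image : ∀ φ {X U} → U IsImageOf X → X ⊨ subst σ φ → U ⊨ φ
  subst-to-image (p i) {X} I h =
    from (flat _ (cp i)) (image-all I (to (flat X (σ i)) (to (emb-sat X (σ i)) h)))
  subst-to-image (np i) I h =
    from (flat _ (cnp i)) (image-all I λ s x → to ¬T⇔T-not (h s x ∘ from (singleton s (σ i))))
  subst-to-image (¬c α) I h = image-all I λ s x → h s x ∘ from (singleton-subst α s)
  subst-to-image ⊤f I h = tt
  subst-to-image NE I (lift h) = lift (to (image-nonempty I) h)
  subst-to-image ⊥f I (lift h) = lift (to (image-empty I) h)
  subst-to-image (indep as bs) I h = image-all₂ I λ s s' x x' →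
    push-witness I (map₂ (map₂ λ { (r , r') → to (sim-subst as s _) r , to (sim-subst bs s' _) r' })
                         (h s s' x x'))
  subst-to-image (dep as β) I h = image-all₂ I λ s s' x x' →
    to (sim-subst (β ∷ []) s s') ∘ h s s' x x' ∘ from (sim-subst as s s')
  subst-to-image (incl as bs) I h = image-all I λ s x →
    push-witness I (map₂ (map₂ (to (simV-subst as bs s _))) (h s x))
  subst-to-image (φ ∧f ψ) I (hφ , hψ) = subst-to-image φ I hφ , subst-to-image ψ I hψ
  subst-to-image (φ ⊗f ψ) I (Y , Z , lift u , hφ , hψ) =
    image Y , image Z , lift (image-union I u) ,
    subst-to-image φ (image-isImage Y) hφ , subst-to-image ψ (image-isImage Z) hψ
  subst-to-image (φ ⊛f ψ) I (inj₁ (lift e)) = inj₁ (lift (to (image-empty I) e))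
  subst-to-image (φ ⊛f ψ) I (inj₂ (Y , Z , lift (u , neY , neZ) , hφ , hψ)) =
    inj₂ (image Y , image Z ,
          lift (image-union I u , to (image-nonempty (image-isImage Y)) neY ,
                                  to (image-nonempty (image-isImage Z)) neZ) ,
          subst-to-image φ (image-isImage Y) hφ , subst-to-image ψ (image-isImage Z) hψ)
  subst-to-image (φ ∨f ψ) I h = ⊎-map (subst-to-image φ I) (subst-to-image ψ I) h

  image-to-subst : ∀ φ {X U} → U IsImageOf X → U ⊨ φ → X ⊨ subst σ φ
  image-to-subst (p i) {X} I h =
    from (emb-sat X (σ i)) (from (flat X (σ i)) λ s x → to (flat _ (cp i)) h _ (in-image I x))
  image-to-subst (np i) I h s x =
    from ¬T⇔T-not (to (flat _ (cnp i)) h _ (in-image I x)) ∘ to (singleton s (σ i))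
  image-to-subst (¬c α) I h s x = h _ (in-image I x) ∘ to (singleton-subst α s)
  image-to-subst ⊤f I h = tt
  image-to-subst NE I (lift h) = lift (from (image-nonempty I) h)
  image-to-subst ⊥f I (lift h) = lift (from (image-empty I) h)
  image-to-subst (indep as bs) I h s s' x x' =
    map₂ (map₂ λ { (r , r') → from (sim-subst as s _) r , from (sim-subst bs s' _) r' })
         (pull-witness I (h _ _ (in-image I x) (in-image I x')))
  image-to-subst (dep as β) I h s s' x x' =
    from (sim-subst (β ∷ []) s s') ∘ h _ _ (in-image I x) (in-image I x') ∘ to (sim-subst as s s')
  image-to-subst (incl as bs) I h s x =
    map₂ (map₂ (from (simV-subst as bs s _))) (pull-witness I (h _ (in-image I x)))
  image-to-subst (φ ∧f ψ) I (hφ , hψ) = image-to-subst φ I hφ , image-to-subst ψ I hψ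
  image-to-subst (φ ⊗f ψ) {X} I (V , W , lift u , hφ , hψ) =
    preimage X V , preimage X W , lift (preimage-union I u) ,
    image-to-subst φ (preimage-image I (⊆-unionˡ u)) hφ ,
    image-to-subst ψ (preimage-image I (⊆-unionʳ u)) hψ
  image-to-subst (φ ⊛f ψ) I (inj₁ (lift e)) = inj₁ (lift (from (image-empty I) e))
  image-to-subst (φ ⊛f ψ) {X} I (inj₂ (V , W , lift (u , neV , neW) , hφ , hψ)) =
    inj₂ (preimage X V , preimage X W ,
          lift (preimage-union I u , from (image-nonempty (preimage-image I (⊆-unionˡ u))) neV ,
                                     from (image-nonempty (preimage-image I (⊆-unionʳ u))) neW) ,
          image-to-subst φ (preimage-image I (⊆-unionˡ u)) hφ ,
          image-to-subst ψ (preimage-image I (⊆-unionʳ u)) hψ)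
  image-to-subst (φ ∨f ψ) I h = ⊎-map (image-to-subst φ I) (image-to-subst ψ I) h

theorem4p3 : (Γ : MPT → Set) (φ : MPT) (σ : ClassicalSubst) →
    Γ ⊩ φ → substSet σ Γ ⊩ subst σ φ
theorem4p3 Γ φ σ Γ⊩φ X X⊨σΓ = image-to-subst σ φ (image-isImage σ X) (Γ⊩φ (image σ X) image⊨Γ)
  where
  image⊨Γ : ∀ γ → Γ γ → image σ X ⊨ γ
  image⊨Γ γ γ∈Γ = subst-to-image σ γ (image-isImage σ X) (X⊨σΓ (subst σ γ) (γ , γ∈Γ , refl))
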